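{- Let $G$ be a connected graph. Then $l(G)=1$ if and only if $G$ is a path graph.
   Context: For $a\neq b$ in $\{1,\ldots,n\}$, $(a\to b)$ denotes the transformation mapping $a$ to $b$ and fixing every other point; transformations are composed left to right. For a digraph $D$ on $\{1,\ldots,n\}$ (no loops, no multiple arcs), $\langle D\rangle$ is the semigroup generated by all $(a\to b)$ with $(a,b)$ an arc. A graph is a digraph in which $(u,v)$ is an arc iff $(v,u)$ is. A cycle of length $k$ of a transformation $\alpha$ is a sequence of distinct points $a_0,\ldots,a_{k-1}$ with $a_i\alpha=a_{i+1}$ (indices mod $k$); $l(\alpha)$ is the length of a longest cycle of $\alpha$, and $l(D)=\max\{l(\alpha):\alpha\in\langle D\rangle\}$. The path graph $P_n$ has vertices $1,\ldots,n$ and edges $\{i,i+1\}$, $1\le i\le n-1$. -}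

module Defs where

open import Level using (0ℓ)
open import Data.Nat using (ℕ; zero; suc; _≤_; _+_)
open import Data.Fin using (Fin; zero; suc; toℕ; _≟_)
open import Data.Maybe using (Maybe; just; nothing; maybe)
import Data.Maybe as Maybe
open import Data.Product using (Σ; _×_; _,_)
open import Data.Sum using (_⊎_)
open import Data.Empty using (⊥)
open import Function using (id; _⇔_; Injective)
open import Function.Bundles using (_↔_; Inverse)
open import Relation.Nullary using (¬_; yes; no)
open import Relation.Binary.PropositionalEquality using (_≡_; _≢_)
open import Relation.Binary.Construct.Closure.ReflexiveTransitive using (Star)

Transf : ℕ → Set
Transf n = Fin n → Fin n

-- Composition left to right: x (α ⨾ β) = (x α) β.
_⨾_ : ∀ {n} → Transf n → Transf n → Transf n
(α ⨾ β) x = β (α x)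

⟨_↦_⟩ : ∀ {n} → Fin n → Fin n → Transf n
⟨ a ↦ b ⟩ x with x ≟ a
... | yes _ = b
... | no  _ = x

record Digraph (n : ℕ) : Set₁ where
  field
    Arc     : Fin n → Fin n → Set
    noLoops : ∀ {u} → ¬ Arc u u

record Graph (n : ℕ) : Set₁ where
  field
    digraph : Digraph n
  open Digraph digraph public
  field
    symmetric : ∀ {u v} → Arc u v → Arc v u

data InSemigroup {n : ℕ} (D : Digraph n) : Transf n → Set where
  gen  : ∀ {a b} → Digraph.Arc D a b → InSemigroup D ⟨ a ↦ b ⟩
  comp : ∀ {α β} → InSemigroup D α → InSemigroup D β → InSemigroup D (α ⨾ β)

-- Cyclic successor on Fin (suc m): i ↦ i+1 mod (suc m).
sucMaybe : ∀ {m} → Fin (suc m) → Maybe (Fin (suc m))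
sucMaybe {zero}  zero    = nothing
sucMaybe {suc m} zero    = just (suc zero)
sucMaybe {suc m} (suc i) = Maybe.map suc (sucMaybe {m} i)

csuc : ∀ {m} → Fin (suc m) → Fin (suc m)
csuc i = maybe id zero (sucMaybe i)

HasCycle : ∀ {n} → Transf n → ℕ → Set
HasCycle α zero    = ⊥
HasCycle {n} α (suc m) =
  Σ (Fin (suc m) → Fin n) λ a →
    (∀ i j → a i ≡ a j → i ≡ j) × (∀ i → α (a i) ≡ a (csuc i))

-- l(D) = k : k is the maximum of the cycle lengths over all α ∈ ⟨D⟩.
LengthIs : ∀ {n} → Digraph n → ℕ → Set
LengthIs {n} D k =
  (Σ (Transf n) λ α → InSemigroup D α × HasCycle α k) ×
  (∀ α → InSemigroup D α → ∀ m → HasCycle α m → m ≤ k)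

Connected : ∀ {n} → Graph n → Set
Connected {n} G = ∀ (u v : Fin n) → Star (Graph.Arc G) u v

PathAdj : ∀ {n} → Fin n → Fin n → Set
PathAdj i j = (toℕ i + 1 ≡ toℕ j) ⊎ (toℕ j + 1 ≡ toℕ i)

IsPathGraph : ∀ {n} → Graph n → Set
IsPathGraph {n} G =
  Σ (Fin n ↔ Fin n) λ σ →
    ∀ u v → Graph.Arc G u v ⇔ PathAdj (Inverse.to σ u) (Inverse.to σ v)

module Submission where

-- (⇐) Number the vertices along the path.  A generator (a → b) moves a to a
--     neighbouring position, so it never reverses the order of two points;
--     hence every element of ⟨G⟩ is monotone for that numbering.  A monotone
--     map cannot carry a cycle of length ≥ 2 (the ranks along the cycle would
--     have to increase strictly all the way round), while the target of any
--     generator is a fixed point, i.e. a cycle of length 1.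
-- (⇒) If l(G) ≤ 1 then ⟨G⟩ contains no transformation swapping two distinct
--     points ("swap-free").  Explicit products of generators show that in a
--     swap-free graph no vertex has three neighbours and no path has a chord.
--     Growing a path one vertex at a time (a vertex off the path is joined to
--     it by a walk; the walk enters the path at an endpoint, since an interior
--     entry would give a third neighbour) yields a Hamiltonian path, and the
--     absence of chords makes its numbering an isomorphism onto P_n.

open import Defs
open import Data.Nat
  using (ℕ; zero; suc; _≤_; _<_; _>_; _+_; _≤′_; ≤′-reflexive; ≤′-step; z≤n; s≤s; s≤s⁻¹; z<s)
  renaming (_≟_ to _ℕ-≟_)
open import Data.Nat.Properties
  using (≤-refl; ≤-trans; ≤-<-trans; <-trans; <-irrefl; <⇒≤; ≤∧≢⇒<; <-cmp; +-comm; m≤m+n;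
         m≤n⇒m<n∨m≡n; m≤n⇒m≤1+n; <⇒≢; ≤′⇒≤; ≤⇒≤′; <⇒≱; anyUpTo?; n<1+n)
open import Data.Fin using (Fin; zero; suc; toℕ; inject₁; fromℕ; fromℕ<; _≟_)
open import Data.Fin.Properties
  using (toℕ-injective; toℕ-fromℕ<; toℕ<n; ¬∀⟶∃¬; injective⇒≤)
  renaming (suc-injective to Fin-suc-injective)
open import Data.Fin.Induction using (<-weakInduction)
open import Data.Maybe using (just; nothing)
open import Data.Maybe.Properties using (just-injective)
open import Data.Product using (∃; ∃₂; _×_; _,_; proj₁; proj₂)
open import Data.Sum using (_⊎_; inj₁; inj₂)
open import Data.Empty using (⊥; ⊥-elim)
open import Function using (_∘_; _|>_; _⇔_; mk⇔; Equivalence)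
open import Function.Bundles using (_↔_; Inverse; mk↔ₛ′)
open import Relation.Nullary using (¬_; yes; no; Dec)
open import Relation.Binary.Definitions using (Tri; tri<; tri≈; tri>)
open import Relation.Binary.PropositionalEquality
  using (_≡_; _≢_; refl; sym; trans; cong; subst; subst₂; module ≡-Reasoning)
open import Relation.Binary.Construct.Closure.ReflexiveTransitive using (Star; ε; _◅_)

↦-moves : ∀ {n} {a b e : Fin n} → e ≡ a → ⟨ a ↦ b ⟩ e ≡ b
↦-moves {a = a} {e = e} refl with e ≟ a
... | yes _   = refl
... | no a≢a  = ⊥-elim (a≢a refl)

↦-keeps : ∀ {n} {a b e y : Fin n} → y ≢ a → e ≡ y → ⟨ a ↦ b ⟩ e ≡ y
↦-keeps {a = a} {e = e} y≢a refl with e ≟ a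
... | yes y≡a = ⊥-elim (y≢a y≡a)
... | no _    = refl

sucMaybe-inject₁ : ∀ {m} (i : Fin m) → sucMaybe (inject₁ i) ≡ just (suc i)
sucMaybe-inject₁ {suc m}       zero    = refl
sucMaybe-inject₁ {suc (suc m)} (suc i) rewrite sucMaybe-inject₁ i = refl

sucMaybe-last : ∀ m → sucMaybe (fromℕ m) ≡ nothing
sucMaybe-last zero    = refl
sucMaybe-last (suc m) rewrite sucMaybe-last m = refl

sucMaybe-not-self : ∀ {m} (i : Fin (suc m)) → sucMaybe i ≢ just i
sucMaybe-not-self {zero}  zero ()
sucMaybe-not-self {suc m} zero ()
sucMaybe-not-self {suc m} (suc i) e with sucMaybe i in e′
... | just j  = sucMaybe-not-self i (trans e′ (cong just (Fin-suc-injective (just-injective e))))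
... | nothing with () ← e

csuc-inject₁ : ∀ {m} (i : Fin m) → csuc (inject₁ i) ≡ suc i
csuc-inject₁ i rewrite sucMaybe-inject₁ i = refl

csuc-last : ∀ m → csuc (fromℕ m) ≡ zero
csuc-last m rewrite sucMaybe-last m = refl

csuc-induction : ∀ {m} (P : Fin (suc m) → Set) → P zero → (∀ i → P i → P (csuc i)) → ∀ i → P i
csuc-induction P P₀ step = <-weakInduction P P₀ (λ i Pi → subst P (csuc-inject₁ i) (step _ Pi))

csuc-not-fixed : ∀ {m} (i : Fin (suc (suc m))) → csuc i ≢ i
csuc-not-fixed i csuc-i≡i with sucMaybe i in eq
... | just j  = sucMaybe-not-self i (trans eq (cong just csuc-i≡i))
-- (csuc i is zero here, so i = zero, for which sucMaybe is not nothing)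
csuc-not-fixed zero refl | nothing with () ← eq

swap⇒2-cycle : ∀ {n} {α : Transf n} {x y} → x ≢ y → α x ≡ y → α y ≡ x → HasCycle α 2
swap⇒2-cycle {n} {α} {x} {y} x≢y αx≡y αy≡x = point , point-injective , cycle
  where
  point : Fin 2 → Fin n
  point zero       = x
  point (suc zero) = y
  point-injective : ∀ i j → point i ≡ point j → i ≡ j
  point-injective zero       zero       _ = refl
  point-injective zero       (suc zero) e = ⊥-elim (x≢y e)
  point-injective (suc zero) zero       e = ⊥-elim (x≢y (sym e))
  point-injective (suc zero) (suc zero) _ = refl
  cycle : ∀ i → α (point i) ≡ point (csuc i)
  cycle zero       = αx≡y
  cycle (suc zero) = αy≡x

-- Values along a cycle cannot strictly climb all the way round: if a
-- transitive irreflexive relation holds at the first step and propagates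
-- from each step to the next, then it holds at every step and hence,
-- by transitivity, from the start back to the start.
cycle-cannot-climb : ∀ {m} {A : Set} (_≺_ : A → A → Set) →
  (∀ {a b c} → a ≺ b → b ≺ c → a ≺ c) → (∀ {a} → ¬ a ≺ a) →
  (g : Fin (suc m) → A) → g zero ≺ g (csuc zero) →
  (∀ i → g i ≺ g (csuc i) → g (csuc i) ≺ g (csuc (csuc i))) → ⊥
cycle-cannot-climb {m} _≺_ ≺-trans ≺-irrefl g first propagate =
  ≺-irrefl (subst (λ i → g zero ≺ g i) (csuc-last m) (from-start (fromℕ m)))
  where
  every-step : ∀ i → g i ≺ g (csuc i)
  every-step = csuc-induction (λ i → g i ≺ g (csuc i)) first propagate
  from-start : ∀ i → g zero ≺ g (csuc i)
  from-start = csuc-induction (λ i → g zero ≺ g (csuc i)) first (λ i lt → ≺-trans lt (every-step (csuc i)))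

module Monotone {n} (rank : Fin n → ℕ) (rank-injective : ∀ {u v} → rank u ≡ rank v → u ≡ v) where

  IsMonotone : Transf n → Set
  IsMonotone α = ∀ {u v} → rank u ≤ rank v → rank (α u) ≤ rank (α v)

  -- A monotone map has only fixed points as cycles: along a longer cycle
  -- consecutive ranks differ, and monotonicity propagates the direction of
  -- the first step, so the ranks would climb (or descend) all the way round.
  monotone-cycles-trivial : ∀ {α} → IsMonotone α → ∀ m → HasCycle α m → m ≤ 1
  monotone-cycles-trivial α-mono zero          ()
  monotone-cycles-trivial α-mono (suc zero)    _     = ≤-refl
  monotone-cycles-trivial {α} α-mono (suc (suc m)) cycle = ⊥-elim (no-long-cycle cycle)
    where
    no-long-cycle : HasCycle α (suc (suc m)) → ⊥
    no-long-cycle (a , a-injective , a-cycle) = compare (<-cmp (g zero) (g (csuc zero)))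
      where
      g : Fin (suc (suc m)) → ℕ
      g i = rank (a i)
      moves : ∀ i → g i ≢ g (csuc i)
      moves i e = csuc-not-fixed i (sym (a-injective _ _ (rank-injective e)))
      advance : ∀ {i j} → g i ≤ g j → g (csuc i) ≤ g (csuc j)
      advance {i} {j} le = subst₂ (λ u v → rank u ≤ rank v) (a-cycle i) (a-cycle j) (α-mono le)
      compare : Tri (g zero < g (csuc zero)) (g zero ≡ g (csuc zero)) (g zero > g (csuc zero)) → ⊥
      compare (tri≈ _ same _) = moves zero same
      compare (tri< up _ _)   = cycle-cannot-climb _<_ <-trans (<-irrefl refl) g up
        (λ i lt → ≤∧≢⇒< (advance (<⇒≤ lt)) (moves (csuc i)))
      compare (tri> _ _ down) = cycle-cannot-climb _>_ (λ p q → <-trans q p) (<-irrefl refl) g down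
        (λ i gt → ≤∧≢⇒< (advance (<⇒≤ gt)) (moves (csuc i) ∘ sym))

-- Moving a point to an adjacent position of a chain never jumps over
-- another point: points strictly below a stay weakly below the new
-- position b, points strictly above a stay weakly above it.
adjacent-keeps-below : ∀ {a b u} → (a + 1 ≡ b ⊎ b + 1 ≡ a) → u < a → u ≤ b
adjacent-keeps-below {a} (inj₁ refl) u<a = ≤-trans (<⇒≤ u<a) (m≤m+n a 1)
adjacent-keeps-below {b = b} {u} (inj₂ refl) u<a = s≤s⁻¹ (subst (u <_) (+-comm b 1) u<a)

adjacent-keeps-above : ∀ {a b v} → (a + 1 ≡ b ⊎ b + 1 ≡ a) → a < v → b ≤ v
adjacent-keeps-above {a} {v = v} (inj₁ refl) a<v = subst (_≤ v) (+-comm 1 a) a<v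
adjacent-keeps-above {b = b} (inj₂ refl) a<v = ≤-trans (m≤m+n b 1) (<⇒≤ a<v)

generator-fixes-target : ∀ {n} (D : Digraph n) {a b} → Digraph.Arc D a b → HasCycle ⟨ a ↦ b ⟩ 1
generator-fixes-target D {a} {b} arc =
  (λ _ → b) , (λ { zero zero _ → refl }) , (λ { zero → ↦-keeps b≢a refl })
  where
  b≢a : b ≢ a
  b≢a refl = Digraph.noLoops D arc

connected⇒arc : ∀ {n} (G : Graph n) → Connected G → ∀ {u v} → u ≢ v → ∃₂ (Graph.Arc G)
connected⇒arc G connected {u} {v} u≢v with connected u v
... | ε        = ⊥-elim (u≢v refl)
... | arc ◅ _  = _ , _ , arc

module PathGraphCycles {n} (G : Graph n) (σ : Fin n ↔ Fin n)
  (iso : ∀ u v → Graph.Arc G u v ⇔ PathAdj (Inverse.to σ u) (Inverse.to σ v)) where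
  open Graph G

  rank : Fin n → ℕ
  rank u = toℕ (Inverse.to σ u)

  rank-injective : ∀ {u v} → rank u ≡ rank v → u ≡ v
  rank-injective {u} {v} e = begin
    u                                   ≡⟨ Inverse.strictlyInverseʳ σ u ⟨
    Inverse.from σ (Inverse.to σ u)     ≡⟨ cong (Inverse.from σ) (toℕ-injective e) ⟩
    Inverse.from σ (Inverse.to σ v)     ≡⟨ Inverse.strictlyInverseʳ σ v ⟩
    v                                   ∎
    where open ≡-Reasoning

  open Monotone rank rank-injective

  -- A generator on an arc moves one point to an adjacent rank, so by the
  -- two lemmas above it is monotone.
  generator-monotone : ∀ {a b} → Arc a b → IsMonotone ⟨ a ↦ b ⟩
  generator-monotone {a} {b} arc {u} {v} u≤v with u ≟ a | v ≟ a
  ... | yes refl | yes refl = ≤-refl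
  ... | no _     | no _     = u≤v
  ... | yes refl | no v≢a   = adjacent-keeps-above (Equivalence.to (iso a b) arc)
                                (≤∧≢⇒< u≤v (λ e → v≢a (sym (rank-injective e))))
  ... | no u≢a   | yes refl = adjacent-keeps-below (Equivalence.to (iso a b) arc)
                                (≤∧≢⇒< u≤v (u≢a ∘ rank-injective))

  -- Monotone maps are closed under composition.
  semigroup-monotone : ∀ {α} → InSemigroup digraph α → IsMonotone α
  semigroup-monotone (gen arc)    = generator-monotone arc
  semigroup-monotone (comp α∈ β∈) = semigroup-monotone β∈ ∘ semigroup-monotone α∈

  path-graph-cycles-trivial : ∀ α → InSemigroup digraph α → ∀ m → HasCycle α m → m ≤ 1
  path-graph-cycles-trivial α α∈ = monotone-cycles-trivial (semigroup-monotone α∈)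

SwapFree : ∀ {n} → Digraph n → Set
SwapFree {n} D = ∀ {α} {x y : Fin n} → InSemigroup D α → x ≢ y → α x ≡ y → α y ≡ x → ⊥

cycles-trivial⇒swap-free : ∀ {n} (D : Digraph n) →
  (∀ α → InSemigroup D α → ∀ m → HasCycle α m → m ≤ 1) → SwapFree D
cycles-trivial⇒swap-free D cycles-trivial α∈ x≢y αx≡y αy≡x
  with cycles-trivial _ α∈ 2 (swap⇒2-cycle x≢y αx≡y αy≡x)
... | s≤s ()

-- The sweep along a sequence p from index i to index j: the product
-- (p i → p (i+1)) ⋯ (p j → p (j+1)).  It carries p i to p (j+1) and fixes
-- every point different from p i, …, p j.
module Sweep {n} (p : ℕ → Fin n) where

  sweep : ∀ {i j} → i ≤′ j → Transf n
  sweep {i} (≤′-reflexive refl) = ⟨ p i ↦ p (suc i) ⟩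
  sweep (≤′-step {j} i≤′j)      = sweep i≤′j ⨾ ⟨ p (suc j) ↦ p (suc (suc j)) ⟩

  sweep-carries : ∀ {i j} (i≤′j : i ≤′ j) → sweep i≤′j (p i) ≡ p (suc j)
  sweep-carries {i} (≤′-reflexive refl) = refl {x = p i} |> ↦-moves
  sweep-carries (≤′-step i≤′j)      = sweep-carries i≤′j |> ↦-moves

  sweep-fixes : ∀ {i j x} (i≤′j : i ≤′ j) → (∀ {k} → i ≤ k → k ≤ j → x ≢ p k) → sweep i≤′j x ≡ x
  sweep-fixes (≤′-reflexive refl) avoids = ↦-keeps (avoids ≤-refl ≤-refl) refl
  sweep-fixes (≤′-step i≤′j)      avoids =
    sweep-fixes i≤′j (λ i≤k k≤j → avoids i≤k (m≤n⇒m≤1+n k≤j))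
    |> ↦-keeps (avoids (m≤n⇒m≤1+n (≤′⇒≤ i≤′j)) ≤-refl)

  sweep-∈ : ∀ (D : Digraph n) {i j} (i≤′j : i ≤′ j) →
    (∀ {k} → i ≤ k → k ≤ j → Digraph.Arc D (p k) (p (suc k))) → InSemigroup D (sweep i≤′j)
  sweep-∈ D (≤′-reflexive refl) arcs = gen (arcs ≤-refl ≤-refl)
  sweep-∈ D (≤′-step i≤′j)      arcs =
    comp (sweep-∈ D i≤′j (λ i≤k k≤j → arcs i≤k (m≤n⇒m≤1+n k≤j)))
         (gen (arcs (m≤n⇒m≤1+n (≤′⇒≤ i≤′j)) ≤-refl))

OnPath : ∀ {n} → (ℕ → Fin n) → ℕ → Fin n → Set
OnPath p M v = ∃ λ j → j < M × p j ≡ v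

onPath? : ∀ {n} (p : ℕ → Fin n) M v → Dec (OnPath p M v)
onPath? p M v = anyUpTo? (λ j → p j ≟ v) M

module Covering {n} (p : ℕ → Fin n) (M : ℕ) (covers : ∀ v → OnPath p M v) where

  position : Fin n → Fin M
  position v = fromℕ< (proj₁ (proj₂ (covers v)))

  position-spec : ∀ v → p (toℕ (position v)) ≡ v
  position-spec v = trans (cong p (toℕ-fromℕ< _)) (proj₂ (proj₂ (covers v)))

  position-injective : ∀ {u v} → position u ≡ position v → u ≡ v
  position-injective {u} {v} e =
    trans (sym (position-spec u)) (trans (cong (p ∘ toℕ) e) (position-spec v))

missed-vertex : ∀ {n} (p : ℕ → Fin n) M → M < n → ∃ λ w → ¬ OnPath p M w
missed-vertex {n} p M M<n = ¬∀⟶∃¬ n (OnPath p M) (onPath? p M) λ covers →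
  <⇒≱ M<n (injective⇒≤ (Covering.position-injective p M covers))

setAt : ∀ {n} → (ℕ → Fin n) → ℕ → Fin n → ℕ → Fin n
setAt p M q i with i ℕ-≟ M
... | yes _ = q
... | no _  = p i

setAt-here : ∀ {n} (p : ℕ → Fin n) M q → setAt p M q M ≡ q
setAt-here p M q with M ℕ-≟ M
... | yes _  = refl
... | no M≢M = ⊥-elim (M≢M refl)

setAt-elsewhere : ∀ {n} (p : ℕ → Fin n) {M} q {i} → i ≢ M → setAt p M q i ≡ p i
setAt-elsewhere p {M} q {i} i≢M with i ℕ-≟ M
... | yes i≡M = ⊥-elim (i≢M i≡M)
... | no _    = refl

below-suc : ∀ {i K} → i < suc K → i < K ⊎ i ≡ K
below-suc = m≤n⇒m<n∨m≡n ∘ s≤s⁻¹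

module InGraph {n} (G : Graph n) where
  open Graph G public

  arc-irreflexive : ∀ {u v} → Arc u v → u ≢ v
  arc-irreflexive arc refl = noLoops arc

  record Path (M : ℕ) : Set where
    field
      vertex   : ℕ → Fin n
      distinct : ∀ {i j} → i < M → j < M → vertex i ≡ vertex j → i ≡ j
      linked   : ∀ {i} → suc i < M → Arc (vertex i) (vertex (suc i))

  path-length-bound : ∀ {M} → Path M → M ≤ n
  path-length-bound {M} P = injective⇒≤ {f = vertex ∘ toℕ} λ e →
    toℕ-injective (distinct (toℕ<n _) (toℕ<n _) e)
    where open Path P

  entering-arc : ∀ p M {u v} → ¬ OnPath p M u → OnPath p M v → Star Arc u v →
    ∃₂ λ q r → Arc q r × ¬ OnPath p M q × OnPath p M r
  entering-arc p M u∉ v∈ ε = ⊥-elim (u∉ v∈)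
  entering-arc p M {u} u∉ v∈ (_◅_ {j = y} arc walk) with onPath? p M y
  ... | yes y∈ = u , y , arc , u∉ , y∈
  ... | no y∉  = entering-arc p M y∉ v∈ walk

  prepend : ∀ {M} (P : Path M) {q} → ¬ OnPath (Path.vertex P) M q → Arc q (Path.vertex P 0) →
    Path (suc M)
  prepend {M} P {q} q∉ arc = record { vertex = vertex′ ; distinct = distinct′ ; linked = linked′ }
    where
    open Path P
    vertex′ : ℕ → Fin n
    vertex′ zero    = q
    vertex′ (suc i) = vertex i
    distinct′ : ∀ {i j} → i < suc M → j < suc M → vertex′ i ≡ vertex′ j → i ≡ j
    distinct′ {zero}  {zero}  _     _     _ = refl
    distinct′ {zero}  {suc j} _     sj<sM e = ⊥-elim (q∉ (j , s≤s⁻¹ sj<sM , sym e))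
    distinct′ {suc i} {zero}  si<sM _     e = ⊥-elim (q∉ (i , s≤s⁻¹ si<sM , e))
    distinct′ {suc i} {suc j} si<sM sj<sM e = cong suc (distinct (s≤s⁻¹ si<sM) (s≤s⁻¹ sj<sM) e)
    linked′ : ∀ {i} → suc i < suc M → Arc (vertex′ i) (vertex′ (suc i))
    linked′ {zero}  _ = arc
    linked′ {suc i} l = linked (s≤s⁻¹ l)

  append : ∀ {M} (P : Path (suc M)) {q} → ¬ OnPath (Path.vertex P) (suc M) q →
    Arc (Path.vertex P M) q → Path (suc (suc M))
  append {M} P {q} q∉ arc = record { vertex = vertex′ ; distinct = distinct′ ; linked = linked′ }
    where
    open Path P
    vertex′ : ℕ → Fin n
    vertex′ = setAt vertex (suc M) q
    old : ∀ {i} → i < suc M → vertex′ i ≡ vertex i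
    old i<sM = setAt-elsewhere vertex q (<⇒≢ i<sM)
    new∉ : ∀ {i} → i < suc M → vertex′ i ≢ vertex′ (suc M)
    new∉ {i} i<sM e = q∉ (i , i<sM , trans (sym (old i<sM)) (trans e (setAt-here vertex (suc M) q)))
    distinct′ : ∀ {i j} → i < suc (suc M) → j < suc (suc M) → vertex′ i ≡ vertex′ j → i ≡ j
    distinct′ i< j< e with below-suc i< | below-suc j<
    ... | inj₂ refl | inj₂ refl = refl
    ... | inj₁ i<sM | inj₂ refl = ⊥-elim (new∉ i<sM e)
    ... | inj₂ refl | inj₁ j<sM = ⊥-elim (new∉ j<sM (sym e))
    ... | inj₁ i<sM | inj₁ j<sM = distinct i<sM j<sM (trans (sym (old i<sM)) (trans e (old j<sM)))
    linked′ : ∀ {i} → suc i < suc (suc M) → Arc (vertex′ i) (vertex′ (suc i))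
    linked′ {i} l with below-suc l
    ... | inj₂ refl = subst₂ Arc (sym (old ≤-refl)) (sym (setAt-here vertex (suc M) q)) arc
    ... | inj₁ si<sM = subst₂ Arc (sym (old (<-trans (n<1+n _) si<sM))) (sym (old si<sM)) (linked si<sM)

module SwapFreeGraph {n} (G : Graph n) (swap-free : SwapFree (Graph.digraph G)) where
  open InGraph G
  open Sweep

  -- No vertex c has three distinct neighbours a, b, d: the product
  -- (a→c)(c→d)(b→c)(c→a)(d→c)(c→b) would swap a and b.
  at-most-two-neighbours : ∀ {c a b d} → Arc c a → Arc c b → Arc c d →
    a ≢ b → a ≢ d → b ≢ d → ⊥
  at-most-two-neighbours {c} {a} {b} {d} ca cb cd a≢b a≢d b≢d = swap-free α∈ a≢b a↦b b↦a
    where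
    α : Transf n
    α = ((((⟨ a ↦ c ⟩ ⨾ ⟨ c ↦ d ⟩) ⨾ ⟨ b ↦ c ⟩) ⨾ ⟨ c ↦ a ⟩) ⨾ ⟨ d ↦ c ⟩) ⨾ ⟨ c ↦ b ⟩
    α∈ : InSemigroup digraph α
    α∈ = comp (comp (comp (comp (comp (gen (symmetric ca)) (gen cd)) (gen (symmetric cb)))
           (gen ca)) (gen (symmetric cd))) (gen cb)
    c≢ : ∀ {x} → Arc c x → x ≢ c
    c≢ arc = arc-irreflexive arc ∘ sym
    -- a goes to c, then d, stays at d through (b→c) and (c→a), returns to c, ends at b
    a↦b : α a ≡ b
    a↦b = refl {x = a} |> ↦-moves |> ↦-moves |> ↦-keeps (b≢d ∘ sym) |> ↦-keeps (c≢ cd)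
               |> ↦-moves |> ↦-moves
    -- b stays at b, goes to c, then a, and stays at a
    b↦a : α b ≡ a
    b↦a = refl {x = b} |> ↦-keeps (a≢b ∘ sym) |> ↦-keeps (c≢ cb) |> ↦-moves |> ↦-moves
               |> ↦-keeps a≢d |> ↦-keeps (c≢ ca)

  -- A path has no chords: an arc from vertex (j+1) back to vertex i with
  -- i < j closes the cycle vertex i, vertex (i+1), …, vertex (j+1), and
  -- sweeping along it, then (vertex i → vertex (i+1)), then
  -- (vertex (j+1) → vertex i) swaps vertex i and vertex (i+1).
  no-chord : ∀ {M} (P : Path M) {i j} → suc i ≤′ j → suc j < M →
    Arc (Path.vertex P (suc j)) (Path.vertex P i) → ⊥
  no-chord {M} P {i} {j} si≤′j sj<M chord = swap-free α∈ x≢y x↦y y↦x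
    where
    open Path P
    x y z : Fin n
    x = vertex i
    y = vertex (suc i)
    z = vertex (suc j)
    si≤j : suc i ≤ j
    si≤j = ≤′⇒≤ si≤′j
    on-path : ∀ {k} → k ≤ suc j → k < M
    on-path k≤sj = ≤-<-trans k≤sj sj<M
    apart : ∀ {k l} → k ≤ suc j → l ≤ suc j → k ≢ l → vertex k ≢ vertex l
    apart k≤ l≤ k≢l = k≢l ∘ distinct (on-path k≤) (on-path l≤)
    i≤sj : i ≤ suc j
    i≤sj = m≤n⇒m≤1+n (<⇒≤ si≤j)
    si≤sj : suc i ≤ suc j
    si≤sj = m≤n⇒m≤1+n si≤j
    α : Transf n
    α = (sweep vertex si≤′j ⨾ ⟨ x ↦ y ⟩) ⨾ ⟨ z ↦ x ⟩
    α∈ : InSemigroup digraph α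
    α∈ = comp (comp (sweep-∈ vertex digraph si≤′j (λ _ k≤j → linked (on-path (s≤s k≤j))))
                    (gen (linked (on-path si≤sj))))
              (gen chord)
    x≢y : x ≢ y
    x≢y = apart i≤sj si≤sj (<⇒≢ ≤-refl)
    y≢z : y ≢ z
    y≢z = apart si≤sj ≤-refl (<⇒≢ (s≤s si≤j))
    x≢z : x ≢ z
    x≢z = apart i≤sj ≤-refl (<⇒≢ (s≤s (<⇒≤ si≤j)))
    -- the sweep moves only vertex (i+1), …, vertex j, so it fixes x and carries y to z
    x↦y : α x ≡ y
    x↦y = sweep-fixes vertex si≤′j (λ si≤k k≤j → apart i≤sj (m≤n⇒m≤1+n k≤j) (<⇒≢ si≤k))
            |> ↦-moves |> ↦-keeps y≢z
    y↦x : α y ≡ x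
    y↦x = sweep-carries vertex si≤′j |> ↦-keeps (x≢z ∘ sym) |> ↦-moves

  arc⇒consecutive : ∀ {M} (P : Path M) {i j} → i < j → j < M →
    Arc (Path.vertex P i) (Path.vertex P j) → suc i ≡ j
  arc⇒consecutive P {i} {j} i<j j<M arc with m≤n⇒m<n∨m≡n i<j
  ... | inj₂ si≡j = si≡j
  arc⇒consecutive P {i} {suc j} i<j sj<M arc | inj₁ (s≤s si≤j) =
    ⊥-elim (no-chord P (≤⇒≤′ si≤j) sj<M (symmetric arc))

  arc⇔consecutive : ∀ {M} (P : Path M) {i j} → i < M → j < M →
    Arc (Path.vertex P i) (Path.vertex P j) ⇔ (i + 1 ≡ j ⊎ j + 1 ≡ i)
  arc⇔consecutive {M} P {i} {j} i<M j<M = mk⇔ to from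
    where
    open Path P
    to : Arc (vertex i) (vertex j) → i + 1 ≡ j ⊎ j + 1 ≡ i
    to arc with <-cmp i j
    ... | tri< i<j _ _ = inj₁ (trans (+-comm i 1) (arc⇒consecutive P i<j j<M arc))
    ... | tri≈ _ refl _ = ⊥-elim (noLoops arc)
    ... | tri> _ _ j<i = inj₂ (trans (+-comm j 1) (arc⇒consecutive P j<i i<M (symmetric arc)))
    linked-at : ∀ {k l} → suc k ≡ l → l < M → Arc (vertex k) (vertex l)
    linked-at refl l<M = linked l<M
    from : i + 1 ≡ j ⊎ j + 1 ≡ i → Arc (vertex i) (vertex j)
    from (inj₁ e) = linked-at (trans (+-comm 1 i) e) j<M
    from (inj₂ e) = symmetric (linked-at (trans (+-comm 1 j) e) i<M)

  -- An arc from outside a path cannot enter it at an interior vertex, which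
  -- would then have three distinct neighbours.
  no-interior-entry : ∀ {M} (P : Path M) {q j} → ¬ OnPath (Path.vertex P) M q →
    suc (suc j) < M → Arc q (Path.vertex P (suc j)) → ⊥
  no-interior-entry {M} P {q} {j} q∉ ssj<M arc =
    at-most-two-neighbours (symmetric (linked sj<M)) (linked ssj<M) (symmetric arc)
      (<⇒≢ (<-trans (n<1+n j) (n<1+n (suc j))) ∘ distinct j<M ssj<M)
      (λ e → q∉ (j , j<M , e))
      (λ e → q∉ (suc (suc j) , ssj<M , e))
    where
    open Path P
    sj<M : suc j < M
    sj<M = <-trans (n<1+n (suc j)) ssj<M
    j<M : j < M
    j<M = <-trans (n<1+n j) sj<M

module ConnectedSwapFreeGraph {N} (G : Graph (suc N)) (swap-free : SwapFree (Graph.digraph G))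
  (connected : Connected G) where
  open InGraph G
  open SwapFreeGraph G swap-free

  -- A walk from a missed vertex to the first vertex of the path enters the
  -- path by some arc q → r; r is not interior, so q extends the path at an end.
  grow : ∀ {M} (P : Path (suc M)) {w} → ¬ OnPath (Path.vertex P) (suc M) w → Path (suc (suc M))
  grow {M} P w∉ with entering-arc (Path.vertex P) (suc M) w∉ (0 , z<s , refl)
                       (connected _ (Path.vertex P 0))
  ... | q , r , qr , q∉ , (zero , _ , first≡r) =
    prepend P q∉ (subst (Arc q) (sym first≡r) qr)
  ... | q , r , qr , q∉ , (suc j , sj<sM , vertex≡r) with below-suc sj<sM
  ...   | inj₂ refl = append P q∉ (subst (λ v → Arc v q) (sym vertex≡r) (symmetric qr))
  ...   | inj₁ sj<M = ⊥-elim (no-interior-entry P q∉ (s≤s sj<M) (subst (Arc q) (sym vertex≡r) qr))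

  path-of-length : ∀ M → M < suc N → Path (suc M)
  path-of-length zero    _      = record
    { vertex   = λ _ → zero
    ; distinct = λ { (s≤s z≤n) (s≤s z≤n) _ → refl }
    ; linked   = λ { (s≤s ()) } }
  path-of-length (suc M) sM<sN = grow P (proj₂ (missed-vertex (Path.vertex P) (suc M) sM<sN))
    where
    P : Path (suc M)
    P = path-of-length M (<-trans (n<1+n M) sM<sN)

  hamiltonian : Path (suc N)
  hamiltonian = path-of-length N ≤-refl

  open Path hamiltonian

  -- The Hamiltonian path visits every vertex: otherwise it could be grown to
  -- a path with more vertices than the graph.
  covers : ∀ v → OnPath vertex (suc N) v
  covers v with onPath? vertex (suc N) v
  ... | yes v∈ = v∈
  ... | no v∉  = ⊥-elim (<-irrefl refl (path-length-bound (grow hamiltonian v∉)))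

  open Covering vertex (suc N) covers

  numbering : Fin (suc N) ↔ Fin (suc N)
  numbering = mk↔ₛ′ position (vertex ∘ toℕ) position-vertex position-spec
    where
    position-vertex : ∀ i → position (vertex (toℕ i)) ≡ i
    position-vertex i =
      toℕ-injective (distinct (toℕ<n _) (toℕ<n i) (position-spec (vertex (toℕ i))))

  path-graph : IsPathGraph G
  path-graph = numbering , λ u v → mk⇔
    (λ arc → Equivalence.to (consecutive (position u) (position v)) (at-positions arc))
    (λ adj → subst₂ Arc (position-spec u) (position-spec v)
               (Equivalence.from (consecutive (position u) (position v)) adj))
    where
    consecutive : ∀ i j → Arc (vertex (toℕ i)) (vertex (toℕ j)) ⇔ PathAdj i j
    consecutive i j = arc⇔consecutive hamiltonian (toℕ<n i) (toℕ<n j)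
    at-positions : ∀ {u v} → Arc u v → Arc (vertex (toℕ (position u))) (vertex (toℕ (position v)))
    at-positions {u} {v} = subst₂ Arc (sym (position-spec u)) (sym (position-spec v))

proposition3p7 : (n : ℕ) → 2 ≤ n → (G : Graph n) → Connected G →
    LengthIs (Graph.digraph G) 1 ⇔ IsPathGraph G
proposition3p7 (suc (suc n)) _ G connected = mk⇔ only-if if
  where
  only-if : LengthIs (Graph.digraph G) 1 → IsPathGraph G
  only-if (_ , cycles-trivial) = ConnectedSwapFreeGraph.path-graph G
    (cycles-trivial⇒swap-free (Graph.digraph G) cycles-trivial) connected
  if : IsPathGraph G → LengthIs (Graph.digraph G) 1
  if (σ , iso) with connected⇒arc G connected {zero} {suc zero} (λ ())
  ... | a , b , arc = (⟨ a ↦ b ⟩ , gen arc , generator-fixes-target (Graph.digraph G) arc)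
                    , PathGraphCycles.path-graph-cycles-trivial G σ iso
proposition3p7 (suc zero) (s≤s ()) _ _
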